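{- Consider an instance of the UKPB with item types $j=1,\dots,n'$, profits $p_j\in\mathbb{N}^+$, weights $w_j\in\mathbb{N}^+$ with $p_j,w_j\le R$, and capacity $C$, the types being ordered so that $p_1/w_1\ge p_2/w_2\ge\dots\ge p_{n'}/w_{n'}$. Let $N_2=\{j : p_j/w_j<p_1/w_1\}$. Then every optimal solution $\mathbf{Y}=(y_1,\dots,y_{n'})$ satisfies $$\sum_{j\in N_2}y_jw_j\le R^3.$$
   Context: The UKPB: maximize $\sum_{j=1}^{n'}p_jx_j$ subject to $\sum_{j=1}^{n'}w_jx_j\le C$, $x_j\in\mathbb{N}$, where $p_j,w_j\in\mathbb{N}^+$, $p_j,w_j\le R$ for a given positive integer $R$. The quantity $p_j/w_j$ is the profit density of type $j$. -}

module Defs where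

open import Data.Nat using (ℕ; zero; suc; _+_; _*_; _≤_; _<_; _^_)
open import Data.Nat.Properties using (_<?_)
open import Data.Fin using (Fin; toℕ)
open import Data.Fin.Base using () renaming (_≤_ to _≤ᶠ_)
open import Data.Product using (_×_)
open import Data.Vec.Functional using (Vector)
open import Relation.Nullary.Decidable using (does)
open import Data.Bool using (if_then_else_)

sumFin : (n : ℕ) → (Fin n → ℕ) → ℕ
sumFin zero f = 0
sumFin (suc n) f = f Data.Fin.zero + sumFin n (λ i → f (Data.Fin.suc i))

-- an instance with n' = suc n item types (types indexed 0 .. n, type 0 = "type 1")
-- profits p, weights w, capacity C

totalWeight : {n : ℕ} → Vector ℕ n → Vector ℕ n → ℕ
totalWeight {n} w x = sumFin n (λ j → w j * x j)

totalProfit : {n : ℕ} → Vector ℕ n → Vector ℕ n → ℕ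
totalProfit {n} p x = sumFin n (λ j → p j * x j)

Feasible : {n : ℕ} → Vector ℕ n → ℕ → Vector ℕ n → Set
Feasible w C x = totalWeight w x ≤ C

Optimal : {n : ℕ} → Vector ℕ n → Vector ℕ n → ℕ → Vector ℕ n → Set
Optimal {n} p w C x =
  Feasible w C x × ((y : Vector ℕ n) → Feasible w C y → totalProfit p y ≤ totalProfit p x)

-- p_i/w_i ≥ p_j/w_j (cross-multiplied, weights positive)
DensityGE : {n : ℕ} → Vector ℕ n → Vector ℕ n → Fin n → Fin n → Set
DensityGE p w i j = p j * w i ≤ p i * w j

SortedByDensity : {n : ℕ} → Vector ℕ n → Vector ℕ n → Set
SortedByDensity {n} p w = (i j : Fin n) → i ≤ᶠ j → DensityGE p w i j

weightInN₂ : {n : ℕ} → Vector ℕ (suc n) → Vector ℕ (suc n) → Vector ℕ (suc n) → ℕ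
weightInN₂ {n} p w y =
  sumFin (suc n) (λ j → if does (p j * w Data.Fin.zero <? p Data.Fin.zero * w j)
                         then y j * w j else 0)

{-# OPTIONS --safe #-}
-- Let W and P be the weight and profit that an optimal solution puts into N₂, and
-- write W = q w₁ + r with r < w₁. Replacing those items by q items of type 1 keeps
-- the solution feasible, so optimality gives p₁ q ≤ P. Every j ∈ N₂ has
-- p_j w₁ + 1 ≤ p₁ w_j, hence R w₁ p_j + w_j ≤ R p₁ w_j because w_j ≤ R; summing,
-- R w₁ P + W ≤ R p₁ W = R p₁ r + R w₁ p₁ q ≤ R p₁ r + R w₁ P.
-- Therefore W ≤ R p₁ r ≤ R³.
module Submission where

open import Defs
open import Data.Bool using (Bool; true; false; if_then_else_; not)
open import Data.Fin using (Fin; zero; suc)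
open import Data.Nat using (ℕ; zero; suc; _+_; _*_; _≤_; _<_; _^_; _/_; _%_; NonZero; >-nonZero; z≤n)
open import Data.Nat.DivMod using (m≡m%n+[m/n]*n; m%n<n; m/n*n≤m)
open import Data.Nat.Properties
open import Data.Nat.Solver using (module +-*-Solver)
open import Data.Product using (_,_)
open import Data.Vec.Functional using (Vector; _∷_; replicate)
open import Function using (_∘_)
open import Relation.Binary.PropositionalEquality
  using (_≡_; _≗_; refl; sym; trans; cong; cong₂; module ≡-Reasoning)
open import Relation.Nullary.Decidable using (Dec; yes; no; does)
open import Algebra.Properties.Semiring.Sum +-*-semiring
  using (sum; ∑-distrib-+; *-distribˡ-sum; sum-cong-≗; sum-replicate-zero)

open +-*-Solver

sumFin≡sum : ∀ n (f : Vector ℕ n) → sumFin n f ≡ sum f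
sumFin≡sum zero    f = refl
sumFin≡sum (suc n) f = cong (f zero +_) (sumFin≡sum n (f ∘ suc))

sumFin-cong : ∀ n {f g : Vector ℕ n} → f ≗ g → sumFin n f ≡ sumFin n g
sumFin-cong n {f} {g} f≗g = trans (sumFin≡sum n f) (trans (sum-cong-≗ f≗g) (sym (sumFin≡sum n g)))

sumFin-distrib-+ : ∀ n (f g : Vector ℕ n) → sumFin n (λ j → f j + g j) ≡ sumFin n f + sumFin n g
sumFin-distrib-+ n f g = begin
  sumFin n (λ j → f j + g j)  ≡⟨ sumFin≡sum n _ ⟩
  sum (λ j → f j + g j)       ≡⟨ ∑-distrib-+ f g ⟩
  sum f + sum g               ≡⟨ sym (cong₂ _+_ (sumFin≡sum n f) (sumFin≡sum n g)) ⟩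
  sumFin n f + sumFin n g     ∎
  where open ≡-Reasoning

sumFin-*ˡ : ∀ n c (f : Vector ℕ n) → sumFin n (λ j → c * f j) ≡ c * sumFin n f
sumFin-*ˡ n c f = begin
  sumFin n (λ j → c * f j)  ≡⟨ sumFin≡sum n _ ⟩
  sum (λ j → c * f j)       ≡⟨ sym (*-distribˡ-sum c f) ⟩
  c * sum f                 ≡⟨ cong (c *_) (sym (sumFin≡sum n f)) ⟩
  c * sumFin n f            ∎
  where open ≡-Reasoning

sumFin-replicate-zero : ∀ n → sumFin n (replicate n 0) ≡ 0
sumFin-replicate-zero n = trans (sumFin≡sum n _) (sum-replicate-zero n)

sumFin-mono-≤ : ∀ n {f g : Vector ℕ n} → (∀ j → f j ≤ g j) → sumFin n f ≤ sumFin n g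
sumFin-mono-≤ zero    f≤g = z≤n
sumFin-mono-≤ (suc n) f≤g = +-mono-≤ (f≤g zero) (sumFin-mono-≤ n (f≤g ∘ suc))

-- totalProfit unfolds to the same sum as totalWeight, so these lemmas serve for both.
totalWeight-cong : ∀ {n} (a : Vector ℕ n) {x x' : Vector ℕ n} →
  x ≗ x' → totalWeight a x ≡ totalWeight a x'
totalWeight-cong a x≗x' = sumFin-cong _ (cong (a _ *_) ∘ x≗x')

totalWeight-+ : ∀ {n} (a x x' : Vector ℕ n) →
  totalWeight a (λ j → x j + x' j) ≡ totalWeight a x + totalWeight a x'
totalWeight-+ {n} a x x' =
  trans (sumFin-cong n (λ j → *-distribˡ-+ (a j) (x j) (x' j)))
        (sumFin-distrib-+ n (λ j → a j * x j) (λ j → a j * x' j))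

totalWeight-single : ∀ {n} (a : Vector ℕ (suc n)) q → totalWeight a (q ∷ replicate n 0) ≡ a zero * q
totalWeight-single {n} a q = begin
  a zero * q + sumFin n (λ i → a (suc i) * 0)  ≡⟨ cong (a zero * q +_) (sumFin-cong n (*-zeroʳ ∘ a ∘ suc)) ⟩
  a zero * q + sumFin n (replicate n 0)        ≡⟨ cong (a zero * q +_) (sumFin-replicate-zero n) ⟩
  a zero * q + 0                               ≡⟨ +-identityʳ _ ⟩
  a zero * q                                   ∎
  where open ≡-Reasoning

optimal-exchange : ∀ {n} {p w : Vector ℕ n} {C} {y} (u v v' : Vector ℕ n) →
  y ≗ (λ j → u j + v j) → Optimal p w C y →
  totalWeight w v' ≤ totalWeight w v → totalProfit p v' ≤ totalProfit p v
optimal-exchange {p = p} {w} {C} {y} u v v' y≗u+v (feasible , optimal) lighter =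
  +-cancelˡ-≤ (totalProfit p u) _ _ (begin
    totalProfit p u + totalProfit p v'   ≡⟨ totalWeight-+ p u v' ⟨
    totalProfit p (λ j → u j + v' j)     ≤⟨ optimal _ feasible′ ⟩
    totalProfit p y                      ≡⟨ totalWeight-cong p y≗u+v ⟩
    totalProfit p (λ j → u j + v j)      ≡⟨ totalWeight-+ p u v ⟩
    totalProfit p u + totalProfit p v    ∎)
  where
  open ≤-Reasoning
  feasible′ : Feasible w C (λ j → u j + v' j)
  feasible′ = begin
    totalWeight w (λ j → u j + v' j)     ≡⟨ totalWeight-+ w u v' ⟩
    totalWeight w u + totalWeight w v'   ≤⟨ +-monoʳ-≤ _ lighter ⟩
    totalWeight w u + totalWeight w v    ≡⟨ totalWeight-+ w u v ⟨
    totalWeight w (λ j → u j + v j)      ≡⟨ totalWeight-cong w y≗u+v ⟨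
    totalWeight w y                      ≤⟨ feasible ⟩
    C                                    ∎

restrict : ∀ {n} → (Fin n → Bool) → Vector ℕ n → Vector ℕ n
restrict S x j = if S j then x j else 0

restrict-split : ∀ {n} (S : Fin n → Bool) (x : Vector ℕ n) →
  x ≗ (λ j → restrict (not ∘ S) x j + restrict S x j)
restrict-split S x j with S j
... | true  = refl
... | false = sym (+-identityʳ (x j))

N₂ : ∀ {n} (p w : Vector ℕ (suc n)) → Fin (suc n) → Bool
N₂ p w j = does (p j * w zero <? p zero * w j)

weightInN₂≡totalWeight-restrict : ∀ {n} (p w y : Vector ℕ (suc n)) →
  weightInN₂ p w y ≡ totalWeight w (restrict (N₂ p w) y)
weightInN₂≡totalWeight-restrict {n} p w y = sumFin-cong (suc n) select-*
  where
  select-* : ∀ j → (if N₂ p w j then y j * w j else 0) ≡ w j * restrict (N₂ p w) y j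
  select-* j with N₂ p w j
  ... | true  = *-comm (y j) (w j)
  ... | false = sym (*-zeroʳ (w j))

-- Integrality turns the strict density gap into a gap of at least 1, worth R ≥ w_j.
density-gap : ∀ {R p₁ w₁ pⱼ wⱼ} → pⱼ * w₁ < p₁ * wⱼ → wⱼ ≤ R → R * (pⱼ * w₁) + wⱼ ≤ R * (p₁ * wⱼ)
density-gap {R} {p₁} {w₁} {pⱼ} {wⱼ} gap wⱼ≤R = begin
  R * (pⱼ * w₁) + wⱼ      ≤⟨ +-monoʳ-≤ (R * (pⱼ * w₁)) wⱼ≤R ⟩
  R * (pⱼ * w₁) + R       ≡⟨ trans (+-comm _ R) (sym (*-suc R (pⱼ * w₁))) ⟩
  R * suc (pⱼ * w₁)       ≤⟨ *-monoʳ-≤ R gap ⟩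
  R * (p₁ * wⱼ)           ∎
  where open ≤-Reasoning

density-gap-restricted : ∀ R {p₁ w₁ pⱼ wⱼ} x (j∈N₂? : Dec (pⱼ * w₁ < p₁ * wⱼ)) → wⱼ ≤ R →
  let k = if does j∈N₂? then x else 0 in
  R * w₁ * (pⱼ * k) + wⱼ * k ≤ R * p₁ * (wⱼ * k)
density-gap-restricted R {p₁} {w₁} {pⱼ} {wⱼ} x (yes gap) wⱼ≤R = begin
  R * w₁ * (pⱼ * x) + wⱼ * x  ≡⟨ solve 5 (λ R w₁ pⱼ wⱼ x → R :* w₁ :* (pⱼ :* x) :+ wⱼ :* x
                                             := (R :* (pⱼ :* w₁) :+ wⱼ) :* x) refl R w₁ pⱼ wⱼ x ⟩
  (R * (pⱼ * w₁) + wⱼ) * x    ≤⟨ *-monoˡ-≤ x (density-gap {R} {p₁} {w₁} {pⱼ} gap wⱼ≤R) ⟩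
  R * (p₁ * wⱼ) * x           ≡⟨ solve 4 (λ R p₁ wⱼ x → R :* (p₁ :* wⱼ) :* x
                                             := R :* p₁ :* (wⱼ :* x)) refl R p₁ wⱼ x ⟩
  R * p₁ * (wⱼ * x)           ∎
  where open ≤-Reasoning
density-gap-restricted R {p₁} {w₁} {pⱼ} {wⱼ} x (no _) _ = ≤-reflexive
  (solve 5 (λ R p₁ w₁ pⱼ wⱼ → R :* w₁ :* (pⱼ :* con 0) :+ wⱼ :* con 0 := R :* p₁ :* (wⱼ :* con 0))
     refl R p₁ w₁ pⱼ wⱼ)

N₂-density-bound : ∀ {n} R (p w y : Vector ℕ (suc n)) → (∀ j → w j ≤ R) →
  let W = totalWeight w (restrict (N₂ p w) y); P = totalProfit p (restrict (N₂ p w) y) in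
  R * w zero * P + W ≤ R * p zero * W
N₂-density-bound {n} R p w y w≤R = begin
  R * w₁ * P + W
       ≡⟨ cong (_+ W) (sumFin-*ˡ (suc n) (R * w₁) (λ j → p j * yN₂ j)) ⟨
  sumFin (suc n) (λ j → R * w₁ * (p j * yN₂ j)) + W
       ≡⟨ sumFin-distrib-+ (suc n) (λ j → R * w₁ * (p j * yN₂ j)) (λ j → w j * yN₂ j) ⟨
  sumFin (suc n) (λ j → R * w₁ * (p j * yN₂ j) + w j * yN₂ j)
       ≤⟨ sumFin-mono-≤ (suc n) (λ j →
            density-gap-restricted R {p₁} {w₁} {p j} {w j} (y j) (p j * w₁ <? p₁ * w j) (w≤R j)) ⟩
  sumFin (suc n) (λ j → R * p₁ * (w j * yN₂ j))
       ≡⟨ sumFin-*ˡ (suc n) (R * p₁) (λ j → w j * yN₂ j) ⟩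
  R * p₁ * W
       ∎
  where
  open ≤-Reasoning
  p₁ w₁ W P : ℕ
  p₁ = p zero
  w₁ = w zero
  yN₂ : Vector ℕ (suc n)
  yN₂ = restrict (N₂ p w) y
  W = totalWeight w yN₂
  P = totalProfit p yN₂

-- The items selected by S weigh W, so they can be traded for ⌊W / w₁⌋ items of type 1.
type₁-refill-profit-≤ : ∀ {n} (p w : Vector ℕ (suc n)) {C} (y : Vector ℕ (suc n))
  .{{_ : NonZero (w zero)}} (S : Fin (suc n) → Bool) → Optimal p w C y →
  p zero * (totalWeight w (restrict S y) / w zero) ≤ totalProfit p (restrict S y)
type₁-refill-profit-≤ {n} p w y S optimal = begin
  p zero * q                         ≡⟨ totalWeight-single p q ⟨
  totalProfit p (q ∷ replicate n 0)
       ≤⟨ optimal-exchange {p = p} {w} (restrict (not ∘ S) y) (restrict S y) (q ∷ replicate n 0)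
                           (restrict-split S y) optimal lighter ⟩
  totalProfit p (restrict S y)       ∎
  where
  open ≤-Reasoning
  W q : ℕ
  W = totalWeight w (restrict S y)
  q = W / w zero
  lighter : totalWeight w (q ∷ replicate n 0) ≤ W
  lighter = begin
    totalWeight w (q ∷ replicate n 0)  ≡⟨ totalWeight-single w q ⟩
    w zero * q                         ≡⟨ *-comm (w zero) q ⟩
    q * w zero                         ≤⟨ m/n*n≤m W (w zero) ⟩
    W                                  ∎

weight-≤-remainder : ∀ {R p₁ w₁ P W} .{{_ : NonZero w₁}} →
  p₁ * (W / w₁) ≤ P → R * w₁ * P + W ≤ R * p₁ * W → W ≤ R * p₁ * (W % w₁)
weight-≤-remainder {R} {p₁} {w₁} {P} {W} refill gap =
  +-cancelˡ-≤ (R * w₁ * (p₁ * q)) W (R * p₁ * r) (begin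
  R * w₁ * (p₁ * q) + W           ≤⟨ +-monoˡ-≤ W (*-monoʳ-≤ (R * w₁) refill) ⟩
  R * w₁ * P + W                  ≤⟨ gap ⟩
  R * p₁ * W                      ≡⟨ cong (R * p₁ *_) (m≡m%n+[m/n]*n W w₁) ⟩
  R * p₁ * (r + q * w₁)           ≡⟨ solve 5 (λ R p₁ w₁ q r → R :* p₁ :* (r :+ q :* w₁)
                                               := R :* w₁ :* (p₁ :* q) :+ R :* p₁ :* r) refl R p₁ w₁ q r ⟩
  R * w₁ * (p₁ * q) + R * p₁ * r  ∎)
  where
  open ≤-Reasoning
  q r : ℕ
  q = W / w₁
  r = W % w₁

*-≤-cube : ∀ {R a b} → a ≤ R → b ≤ R → R * a * b ≤ R ^ 3
*-≤-cube {R} a≤R b≤R = ≤-trans (*-mono-≤ (*-monoʳ-≤ R a≤R) b≤R)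
                               (≤-reflexive (solve 1 (λ R → R :* R :* R := R :^ 3) refl R))

theorem7 : (n R C : ℕ) (p w : Vector ℕ (suc n))
    → ((j : Fin (suc n)) → 0 < p j) → ((j : Fin (suc n)) → 0 < w j)
    → ((j : Fin (suc n)) → p j ≤ R) → ((j : Fin (suc n)) → w j ≤ R)
    → SortedByDensity p w
    → (y : Vector ℕ (suc n)) → Optimal p w C y
    → weightInN₂ p w y ≤ R ^ 3
theorem7 n R C p w _ w>0 p≤R w≤R _ y optimal = begin
  weightInN₂ p w y       ≡⟨ weightInN₂≡totalWeight-restrict p w y ⟩
  W                      ≤⟨ weight-≤-remainder {R} {p zero} {w₁} refill (N₂-density-bound R p w y w≤R) ⟩
  R * p zero * (W % w₁)  ≤⟨ *-≤-cube (p≤R zero) (≤-trans (<⇒≤ (m%n<n W w₁)) (w≤R zero)) ⟩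
  R ^ 3                  ∎
  where
  open ≤-Reasoning
  w₁ : ℕ
  w₁ = w zero
  instance
    w₁≢0 : NonZero w₁
    w₁≢0 = >-nonZero (w>0 zero)
  W : ℕ
  W = totalWeight w (restrict (N₂ p w) y)
  refill : p zero * (W / w₁) ≤ totalProfit p (restrict (N₂ p w) y)
  refill = type₁-refill-profit-≤ p w y (N₂ p w) optimal
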